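{- Let $G=(V,E)$ be a connected split graph and $t\in V$. Then $t$ is the last vertex of some MCS ordering of $G$ if and only if (1) $t$ is simplicial, and (2) the neighbourhoods $N(v)$ of the vertices $v$ with $\deg(v)<\deg(t)$ are totally ordered by inclusion.
   Context: A split graph is a graph whose vertex set can be partitioned into a clique and an independent set. A vertex is simplicial if its neighbourhood is a clique. An MCS ordering of a graph with $n$ vertices is any ordering produced by: the first vertex is arbitrary; at each subsequent step, number next an unnumbered vertex having the largest number of already numbered neighbours (any tie-break allowed). -}

module Defs where

open import Data.Nat using (ℕ; suc; _<_; _≤_)
open import Data.Nat.Properties using (_<?_)
open import Data.Bool using (Bool; true; false; T; _∧_)
open import Data.Fin using (Fin; toℕ)
open import Data.List using (List; length; filterᵇ; allFin)
open import Data.Product using (Σ; _×_; ∃)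
open import Data.Sum using (_⊎_)
open import Relation.Nullary using (¬_; does)
open import Relation.Binary.PropositionalEquality using (_≡_; _≢_)
open import Relation.Binary.Construct.Closure.ReflexiveTransitive using (Star)
open import Function.Definitions using (Injective)

record Graph (n : ℕ) : Set where
  field
    adj    : Fin n → Fin n → Bool
    sym    : ∀ u v → adj u v ≡ adj v u
    irrefl : ∀ v → adj v v ≡ false

module _ {n : ℕ} (G : Graph n) where
  open Graph G

  Adj : Fin n → Fin n → Set
  Adj u v = T (adj u v)

  deg : Fin n → ℕ
  deg v = length (filterᵇ (adj v) (allFin n))

  Connected : Set
  Connected = ∀ u v → Star Adj u v

  IsSplit : Set
  IsSplit = Σ (Fin n → Bool) λ K →
      (∀ u v → T (K u) → T (K v) → u ≢ v → Adj u v)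
    × (∀ u v → ¬ T (K u) → ¬ T (K v) → ¬ Adj u v)

  Simplicial : Fin n → Set
  Simplicial t = ∀ u w → Adj t u → Adj t w → u ≢ w → Adj u w

  _⊆N_ : Fin n → Fin n → Set
  v ⊆N w = ∀ x → Adj v x → Adj w x

  LowerNbhdsChain : Fin n → Set
  LowerNbhdsChain t = ∀ v w → deg v < deg t → deg w < deg t → (v ⊆N w) ⊎ (w ⊆N v)

  -- For an ordering σ (σ i = vertex numbered at step i), the number of
  -- neighbours of v among the vertices numbered before step i.
  numberedNbrs : (Fin n → Fin n) → Fin n → Fin n → ℕ
  numberedNbrs σ i v =
    length (filterᵇ (λ j → does (toℕ j <? toℕ i) ∧ adj (σ j) v) (allFin n))

  IsMCS : (Fin n → Fin n) → Set
  IsMCS σ = Injective _≡_ _≡_ σ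
    × (∀ i u → (∀ j → toℕ j < toℕ i → σ j ≢ u) → numberedNbrs σ i u ≤ numberedNbrs σ i (σ i))

  LastOfSomeMCS : Fin n → Set
  LastOfSomeMCS t = Σ (Fin n → Fin n) λ σ → IsMCS σ × ∃ λ i → σ i ≡ t × suc (toℕ i) ≡ n

-- Let K be the clique and I the independent side of a split partition.  When MCS picks an
-- independent vertex, its numbered neighbours lie in K and so see every unnumbered clique
-- vertex; by maximality every numbered neighbour of an unnumbered clique vertex then sees the
-- vertex picked.  Applied to the last vertex t, unnumbered throughout, this makes N(t) a clique.
-- A simplicial t can be moved to the independent side, after which the low vertices (degree
-- below deg t) are independent.  If v precedes a low w then N(v) ⊆ N(w): a vertex of
-- N(t) ∖ N(w) comes after w, for otherwise all of K, hence N(t) and N(w), precedes w and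
-- deg t ≤ deg w; a neighbour of v outside N(w) then contradicts the observation above at w.
--
-- Conversely, for independent t an MCS ending at t is built greedily, keeping every unnumbered
-- low vertex adjacent to the numbered clique vertices, with its neighbourhood containing those
-- of the numbered independent vertices.  While K is not exhausted, number a clique vertex of maximum label,
-- unless no unnumbered clique vertex sees a numbered independent one and a low vertex is
-- unnumbered: then number the low vertex of least degree, whose neighbourhood the chain condition
-- puts below those of the other low vertices.  Once K is numbered, labels of independent vertices
-- are their degrees, and t, of least degree among the rest, can wait until last.

module Submission where

open import Defs
open import Data.Nat using (ℕ; zero; suc; _+_; _≤_; _<_; z≤n)
open import Data.Nat.Properties hiding (_≟_)
open import Data.Bool using (Bool; true; false; T; T?; _∧_; _∨_; if_then_else_)
open import Data.Bool.Properties using (T-∧)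
open import Data.Fin using (Fin; zero; suc; toℕ; fromℕ; fromℕ<; punchOut)
open import Data.Fin.Properties
  using (_≟_; any?; punchOut-injective; injective⇒≤; toℕ-injective; toℕ<n; toℕ-fromℕ; toℕ-fromℕ<)
open import Data.Fin.Permutation using (Permutation′; permutation; transpose; _⟨$⟩ʳ_)
open import Data.List using (List; length; filter; filterᵇ; allFin; tabulate)
open import Data.List.Extrema.Nat using (argmax; argmin; argmax-all; argmin-all; f[xs]≤f[argmax]; f[argmin]≤f[xs])
open import Data.List.Membership.Propositional using (_∈_)
open import Data.List.Membership.Propositional.Properties using (∈-filter⁺; ∈-filter⁻; ∈-allFin)
import Data.List.Relation.Unary.All as All
open import Data.Product using (Σ; _×_; _,_; proj₁; proj₂; ∃)
open import Data.Sum using (_⊎_; inj₁; inj₂; [_,_]′)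
open import Function using (_∘_; _⇔_; mk⇔; Equivalence)
open import Function.Definitions using (Injective)
open import Level using (0ℓ)
open import Relation.Nullary using (¬_; ¬?; yes; no; does; contradiction; _×-dec_)
open import Relation.Nullary.Decidable using (decidable-stable)
open import Relation.Unary using (Pred; Decidable)
open import Relation.Binary using (tri<; tri≈; tri>)
open import Relation.Binary.PropositionalEquality
  using (_≡_; _≢_; refl; sym; trans; cong; subst; subst₂; module ≡-Reasoning)
import Algebra.Properties.CommutativeMonoid.Sum +-0-commutativeMonoid as ℕSum

private
  variable
    n : ℕ

∧-intro : ∀ {a b} → T a → T b → T (a ∧ b)
∧-intro x y = Equivalence.from T-∧ (x , y)

∧-elim : ∀ {a b} → T (a ∧ b) → T a × T b
∧-elim = Equivalence.to T-∧

<?-sound : ∀ {x y} → T (does (x <? y)) → x < y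
<?-sound {x} {y} = <ᵇ⇒< x y

<?-complete : ∀ {x y} → x < y → T (does (x <? y))
<?-complete = <⇒<ᵇ

_⊆ᵇ_ : (Fin n → Bool) → (Fin n → Bool) → Set
p ⊆ᵇ q = ∀ z → T (p z) → T (q z)

insert : (Fin n → Bool) → Fin n → Fin n → Bool
insert p u z = does (z ≟ u) ∨ p z

∈-insert-self : (p : Fin n → Bool) (u : Fin n) → T (insert p u u)
∈-insert-self p u with u ≟ u
... | yes _   = _
... | no  u≢u = contradiction refl u≢u

∈-insert⁺ : (p : Fin n → Bool) (u : Fin n) {z : Fin n} → T (p z) → T (insert p u z)
∈-insert⁺ p u {z} pz with z ≟ u
... | yes _ = _
... | no  _ = pz

∈-insert⁻ : (p : Fin n → Bool) (u : Fin n) {z : Fin n} → T (insert p u z) → z ≡ u ⊎ T (p z)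
∈-insert⁻ p u {z} h with z ≟ u
... | yes z≡u = inj₁ z≡u
... | no  _   = inj₂ h

∉-insert : (p : Fin n → Bool) {u z : Fin n} → ¬ T (p z) → z ≢ u → ¬ T (insert p u z)
∉-insert p {u} ¬pz z≢u h = [ z≢u , ¬pz ]′ (∈-insert⁻ p u h)

insert-⊆ᵇ : {p q : Fin n → Bool} {u : Fin n} → p ⊆ᵇ q → T (q u) → insert p u ⊆ᵇ q
insert-⊆ᵇ {u = u} p⊆q qu z h with z ≟ u
... | yes refl = qu
... | no  _    = p⊆q z h

indicator : Bool → ℕ
indicator b = if b then 1 else 0

indicator-mono : ∀ {a b} → (T a → T b) → indicator a ≤ indicator b
indicator-mono {false}         _   = z≤n
indicator-mono {true}  {true}  _   = ≤-refl
indicator-mono {true}  {false} a⇒b = contradiction (a⇒b _) λ ()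

count : (Fin n → Bool) → ℕ
count {zero}  p = 0
count {suc n} p = indicator (p zero) + count (p ∘ suc)

length-filterᵇ-tabulate : ∀ {A : Set} (p : A → Bool) (f : Fin n → A) →
  length (filterᵇ p (tabulate f)) ≡ count (p ∘ f)
length-filterᵇ-tabulate {zero}  p f = refl
length-filterᵇ-tabulate {suc n} p f with p (f zero)
... | true  = cong suc (length-filterᵇ-tabulate p (f ∘ suc))
... | false = length-filterᵇ-tabulate p (f ∘ suc)

length-filterᵇ-allFin : (p : Fin n → Bool) → length (filterᵇ p (allFin n)) ≡ count p
length-filterᵇ-allFin p = length-filterᵇ-tabulate p (λ z → z)

count-none : {p : Fin n → Bool} → (∀ z → ¬ T (p z)) → count p ≡ 0
count-none {zero}      _    = refl
count-none {suc n} {p} none with p zero in p0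
... | true  = contradiction (subst T (sym p0) _) (none zero)
... | false = count-none (none ∘ suc)

count-all : count {n} (λ _ → true) ≡ n
count-all {zero}  = refl
count-all {suc n} = cong suc (count-all {n})

count-insert : (p : Fin n → Bool) (u : Fin n) → ¬ T (p u) → count (insert p u) ≡ suc (count p)
count-insert {suc n} p zero    ¬p0 with p zero
... | true  = contradiction _ ¬p0
... | false = refl
count-insert {suc n} p (suc u) ¬pu =
  trans (cong (indicator (p zero) +_) (count-insert (p ∘ suc) u ¬pu)) (+-suc (indicator (p zero)) _)

count-mono : {p q : Fin n → Bool} → p ⊆ᵇ q → count p ≤ count q
count-mono {zero}  _   = z≤n
count-mono {suc n} p⊆q = +-mono-≤ (indicator-mono (p⊆q zero)) (count-mono (p⊆q ∘ suc))

count-mono-< : {p q : Fin n → Bool} → p ⊆ᵇ q → (a : Fin n) → T (q a) → ¬ T (p a) → count p < count q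
count-mono-< {p = p} {q} p⊆q a qa ¬pa = subst (_≤ count q) (count-insert p a ¬pa) (count-mono (insert-⊆ᵇ p⊆q qa))

count-cong : {p q : Fin n → Bool} → p ⊆ᵇ q → q ⊆ᵇ p → count p ≡ count q
count-cong p⊆q q⊆p = ≤-antisym (count-mono p⊆q) (count-mono q⊆p)

count-≤⇒⊇ : {p q : Fin n → Bool} → p ⊆ᵇ q → count q ≤ count p → q ⊆ᵇ p
count-≤⇒⊇ {p = p} p⊆q q≤p z qz =
  decidable-stable (T? (p z)) (λ ¬pz → <⇒≱ (count-mono-< p⊆q z qz ¬pz) q≤p)

count-<⇒∃ : {p q : Fin n → Bool} → count p < count q → ∃ λ z → T (q z) × ¬ T (p z)
count-<⇒∃ {p = p} {q} p<q with any? (λ z → T? (q z) ×-dec ¬? (T? (p z)))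
... | yes found = found
... | no ¬found = contradiction (count-mono q⊆p) (<⇒≱ p<q)
  where
  q⊆p : q ⊆ᵇ p
  q⊆p z qz = decidable-stable (T? (p z)) (λ ¬pz → ¬found (z , qz , ¬pz))

count≡sum : (p : Fin n → Bool) → count p ≡ ℕSum.sum (indicator ∘ p)
count≡sum {zero}  p = refl
count≡sum {suc n} p = cong (indicator (p zero) +_) (count≡sum (p ∘ suc))

count-permute : (π : Permutation′ n) (p : Fin n → Bool) → count (p ∘ (π ⟨$⟩ʳ_)) ≡ count p
count-permute π p = begin
  count (p ∘ (π ⟨$⟩ʳ_))              ≡⟨ count≡sum (p ∘ (π ⟨$⟩ʳ_)) ⟩
  ℕSum.sum (indicator ∘ p ∘ (π ⟨$⟩ʳ_)) ≡⟨ ℕSum.sum-permute (indicator ∘ p) π ⟨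
  ℕSum.sum (indicator ∘ p)            ≡⟨ count≡sum p ⟨
  count p                             ∎
  where open ≡-Reasoning

-- Pigeonhole: a missed value y would let f inject Fin (suc n) into Fin n by punching y out.
injective⇒surjective : {f : Fin n → Fin n} → Injective _≡_ _≡_ f → ∀ y → ∃ λ x → f x ≡ y
injective⇒surjective {suc n} {f} f-inj y with any? (λ x → f x ≟ y)
... | yes found = found
... | no ¬found = contradiction (injective⇒≤ f′-inj) 1+n≰n
  where
  y≢f : ∀ x → y ≢ f x
  y≢f x y≡fx = ¬found (x , sym y≡fx)
  f′-inj : Injective _≡_ _≡_ (λ x → punchOut (y≢f x))
  f′-inj {x} {x′} e = f-inj (punchOut-injective (y≢f x) (y≢f x′) e)

count-reindex : {f : Fin n → Fin n} → Injective _≡_ _≡_ f → (p : Fin n → Bool) → count (p ∘ f) ≡ count p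
count-reindex {f = f} f-inj = count-permute (permutation f f⁻¹ (proj₂ ∘ onto) (λ x → f-inj (proj₂ (onto (f x)))))
  where
  onto = injective⇒surjective f-inj
  f⁻¹ = proj₁ ∘ onto

module _ {P : Pred (Fin n) 0ℓ} (P? : Decidable P) (f : Fin n → ℕ) {a : Fin n} (Pa : P a) where
  private
    candidates : List (Fin n)
    candidates = filter P? (allFin n)

    all-candidates : All.All P candidates
    all-candidates = All.tabulate (proj₂ ∘ ∈-filter⁻ P? {xs = allFin n})

    candidate : ∀ {y} → P y → y ∈ candidates
    candidate {y} Py = ∈-filter⁺ P? (∈-allFin y) Py

  maximiser : Σ (Fin n) λ u → P u × (∀ y → P y → f y ≤ f u)
  maximiser = argmax f a candidates , argmax-all f Pa all-candidates ,
              λ y Py → All.lookup (f[xs]≤f[argmax] a candidates) (candidate Py)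

  minimiser : Σ (Fin n) λ u → P u × (∀ y → P y → f u ≤ f y)
  minimiser = argmin f a candidates , argmin-all f Pa all-candidates ,
              λ y Py → All.lookup (f[argmin]≤f[xs] a candidates) (candidate Py)

module GraphProperties (G : Graph n) where
  open Graph G renaming (sym to adj-sym)

  Adj-sym : ∀ {u v} → Adj G u v → Adj G v u
  Adj-sym {u} {v} = subst T (adj-sym u v)

  Adj-irrefl : ∀ {v} → ¬ Adj G v v
  Adj-irrefl {v} = subst (¬_ ∘ T) (sym (irrefl v)) λ ()

  deg≡count : ∀ v → deg G v ≡ count (adj v)
  deg≡count v = length-filterᵇ-allFin (adj v)

  deg-mono : ∀ {v w} → _⊆N_ G v w → deg G v ≤ deg G w
  deg-mono {v} {w} v⊆w = subst₂ _≤_ (sym (deg≡count v)) (sym (deg≡count w)) (count-mono v⊆w)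

  ⊆N∧deg≤⇒⊇N : ∀ {v w} → _⊆N_ G v w → deg G w ≤ deg G v → _⊆N_ G w v
  ⊆N∧deg≤⇒⊇N {v} {w} v⊆w w≤v = count-≤⇒⊇ v⊆w (subst₂ _≤_ (deg≡count w) (deg≡count v) w≤v)

  deg<⇒nbr-outside : ∀ {v w} → deg G v < deg G w → ∃ λ z → Adj G w z × ¬ Adj G v z
  deg<⇒nbr-outside {v} {w} v<w = count-<⇒∃ (subst₂ _<_ (deg≡count v) (deg≡count w) v<w)

  Unnumbered : (Fin n → Fin n) → Fin n → Fin n → Set
  Unnumbered σ i u = ∀ j → toℕ j < toℕ i → σ j ≢ u

  numberedNbrPositions : (Fin n → Fin n) → Fin n → Fin n → Fin n → Bool
  numberedNbrPositions σ i v j = does (toℕ j <? toℕ i) ∧ adj (σ j) v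

  numberedNbrs≡count : ∀ σ i v → numberedNbrs G σ i v ≡ count (numberedNbrPositions σ i v)
  numberedNbrs≡count σ i v = length-filterᵇ-allFin (numberedNbrPositions σ i v)

  label : (Fin n → Bool) → Fin n → ℕ
  label S u = count (λ z → S z ∧ adj z u)

  module _ (S : Fin n → Bool) {y u : Fin n} (nbrs⊆ : ∀ z → T (S z) → Adj G z y → Adj G z u) where
    private
      numbered-nbrs⊆ : (λ z → S z ∧ adj z y) ⊆ᵇ (λ z → S z ∧ adj z u)
      numbered-nbrs⊆ z h with z∈S , z~y ← ∧-elim h = ∧-intro z∈S (nbrs⊆ z z∈S z~y)

    label-mono : label S y ≤ label S u
    label-mono = count-mono numbered-nbrs⊆

    label-mono-< : ∀ x → T (S x) → Adj G x u → ¬ Adj G x y → label S y < label S u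
    label-mono-< x x∈S x~u ¬x~y = count-mono-< numbered-nbrs⊆ x (∧-intro x∈S x~u) (¬x~y ∘ proj₂ ∘ ∧-elim)

record SplitPartition (G : Graph n) (K : Fin n → Bool) : Set where
  field
    clique      : ∀ u v → T (K u) → T (K v) → u ≢ v → Adj G u v
    independent : ∀ u v → ¬ T (K u) → ¬ T (K v) → ¬ Adj G u v

module SplitPartitionProperties {G : Graph n} {K : Fin n → Bool} (split : SplitPartition G K) where
  open Graph G using (adj)
  open GraphProperties G
  open SplitPartition split

  nbr-of-independent : ∀ {u v} → ¬ T (K u) → Adj G u v → T (K v)
  nbr-of-independent {u} {v} ¬Ku u~v = decidable-stable (T? (K v)) (λ ¬Kv → independent u v ¬Ku ¬Kv u~v)

  -- Swapping v and t maps the neighbourhood of t into that of v.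
  deg-independent≤deg-clique : ∀ {t v} → ¬ T (K t) → T (K v) → deg G t ≤ deg G v
  deg-independent≤deg-clique {t} {v} ¬Kt Kv = begin
    deg G t                  ≡⟨ deg≡count t ⟩
    count (adj t)            ≤⟨ count-mono swap-nbr ⟩
    count (adj v ∘ (τ ⟨$⟩ʳ_)) ≡⟨ count-permute τ (adj v) ⟩
    count (adj v)            ≡⟨ deg≡count v ⟨
    deg G v                  ∎
    where
    open ≤-Reasoning
    τ = transpose v t
    swap-nbr : ∀ z → Adj G t z → Adj G v (τ ⟨$⟩ʳ z)
    swap-nbr z t~z with z ≟ v
    ... | yes refl = Adj-sym t~z
    ... | no z≢v with z ≟ t
    ...   | yes refl = contradiction t~z Adj-irrefl
    ...   | no _     = clique v z Kv (nbr-of-independent ¬Kt t~z) (z≢v ∘ sym)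

simplicial⇒independent-side : {G : Graph n} {K : Fin n → Bool} {t : Fin n} → SplitPartition G K →
  Simplicial G t → ∃ λ K′ → SplitPartition G K′ × ¬ T (K′ t)
simplicial⇒independent-side {G = G} {K} {t} split simp with T? (K t)
... | no ¬Kt = K , split , ¬Kt
... | yes Kt = Graph.adj G t , record { clique = simp ; independent = indep } , Adj-irrefl
  where
  open GraphProperties G
  open SplitPartition split
  outside-is-t : ∀ x → ¬ Adj G t x → T (K x) → x ≡ t
  outside-is-t x ¬t~x Kx = decidable-stable (x ≟ t) (λ x≢t → ¬t~x (clique t x Kt Kx (x≢t ∘ sym)))
  indep : ∀ u v → ¬ Adj G t u → ¬ Adj G t v → ¬ Adj G u v
  indep u v ¬t~u ¬t~v u~v with T? (K u) | T? (K v)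
  ... | yes Ku | _      with refl ← outside-is-t u ¬t~u Ku = ¬t~v u~v
  ... | no  _  | yes Kv with refl ← outside-is-t v ¬t~v Kv = ¬t~u (Adj-sym u~v)
  ... | no ¬Ku | no ¬Kv = independent u v ¬Ku ¬Kv u~v

module MCSProperties (G : Graph n) {σ : Fin n → Fin n} (mcs : IsMCS G σ) where
  open Graph G using (adj)
  open GraphProperties G

  σ-injective : Injective _≡_ _≡_ σ
  σ-injective = proj₁ mcs

  position : ∀ u → ∃ λ p → σ p ≡ u
  position = injective⇒surjective σ-injective

  unnumbered-later : ∀ {i p} → toℕ i ≤ toℕ p → Unnumbered σ i (σ p)
  unnumbered-later i≤p j j<i σj≡σp with refl ← σ-injective σj≡σp = <⇒≱ j<i i≤p

  -- By maximality of σ i, the unnumbered w cannot have strictly more numbered neighbours.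
  no-better-candidate : ∀ {i w} → Unnumbered σ i w →
    (∀ j → toℕ j < toℕ i → Adj G (σ j) (σ i) → Adj G (σ j) w) →
    ∀ {j} → toℕ j < toℕ i → Adj G (σ j) w → Adj G (σ j) (σ i)
  no-better-candidate {i} {w} w-unn nbrs⊆ {j} j<i σj~w =
    decidable-stable (T? (adj (σ j) (σ i))) λ ¬σj~σi →
      <⇒≱ (count-mono-< numbered⊆ j (∧-intro (<?-complete j<i) σj~w) (¬σj~σi ∘ proj₂ ∘ ∧-elim))
          (subst₂ _≤_ (numberedNbrs≡count σ i w) (numberedNbrs≡count σ i (σ i)) (proj₂ mcs i w w-unn))
    where
    numbered⊆ : numberedNbrPositions σ i (σ i) ⊆ᵇ numberedNbrPositions σ i w
    numbered⊆ j h with j<i , σj~σi ← ∧-elim h = ∧-intro j<i (nbrs⊆ j (<?-sound j<i) σj~σi)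

  numberedNbrs≤deg : ∀ i v → numberedNbrs G σ i v ≤ deg G v
  numberedNbrs≤deg i v = begin
    numberedNbrs G σ i v                   ≡⟨ numberedNbrs≡count σ i v ⟩
    count (numberedNbrPositions σ i v)     ≤⟨ count-mono {q = adj v ∘ σ} (λ j → Adj-sym ∘ proj₂ ∘ ∧-elim) ⟩
    count (adj v ∘ σ)                      ≡⟨ count-reindex σ-injective (adj v) ⟩
    count (adj v)                          ≡⟨ deg≡count v ⟨
    deg G v                                ∎
    where open ≤-Reasoning

  deg≤numberedNbrs : ∀ i v → (∀ j → Adj G v (σ j) → toℕ j < toℕ i) → deg G v ≤ numberedNbrs G σ i v
  deg≤numberedNbrs i v nbrs-numbered = begin
    deg G v                                ≡⟨ deg≡count v ⟩
    count (adj v)                          ≡⟨ count-reindex σ-injective (adj v) ⟨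
    count (adj v ∘ σ)                      ≤⟨ count-mono {p = adj v ∘ σ} numbered ⟩
    count (numberedNbrPositions σ i v)     ≡⟨ numberedNbrs≡count σ i v ⟨
    numberedNbrs G σ i v                   ∎
    where
    open ≤-Reasoning
    numbered : (adj v ∘ σ) ⊆ᵇ numberedNbrPositions σ i v
    numbered j v~σj = ∧-intro (<?-complete (nbrs-numbered j v~σj)) (Adj-sym v~σj)

module LastVertexOfMCS {G : Graph n} {K : Fin n → Bool} (split : SplitPartition G K)
                       {σ : Fin n → Fin n} (mcs : IsMCS G σ) {l : Fin n} (l-last : suc (toℕ l) ≡ n) where
  open Graph G using (adj)
  open GraphProperties G
  open SplitPartition split
  open SplitPartitionProperties split
  open MCSProperties G mcs

  t : Fin n
  t = σ l

  t-unnumbered : ∀ i → Unnumbered σ i t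
  t-unnumbered i = unnumbered-later (≤-pred (subst (toℕ i <_) (sym l-last) (toℕ<n i)))

  -- The numbered neighbours of the independent σ i lie in the clique, so they all see w.
  independent-pick : ∀ {i w j} → ¬ T (K (σ i)) → T (K w) → Unnumbered σ i w →
    toℕ j < toℕ i → Adj G (σ j) w → Adj G (σ j) (σ i)
  independent-pick {i} {w} ¬Kσi Kw w-unn = no-better-candidate w-unn λ j j<i σj~σi →
    clique (σ j) w (nbr-of-independent ¬Kσi (Adj-sym σj~σi)) Kw (w-unn j j<i)

  t-nbr-sees-later-independent : ∀ {p q} → T (K t) → ¬ T (K (σ q)) → toℕ p < toℕ q →
    Adj G (σ p) t → Adj G (σ p) (σ q)
  t-nbr-sees-later-independent Kt ¬Kσq = independent-pick ¬Kσq Kt (t-unnumbered _)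

  independent-nbrs-adjacent : ∀ {p q} → T (K t) → ¬ T (K (σ p)) → ¬ T (K (σ q)) →
    Adj G t (σ p) → Adj G t (σ q) → σ p ≢ σ q → Adj G (σ p) (σ q)
  independent-nbrs-adjacent {p} {q} Kt ¬Kσp ¬Kσq t~σp t~σq σp≢σq with <-cmp (toℕ p) (toℕ q)
  ... | tri< p<q _ _ = t-nbr-sees-later-independent Kt ¬Kσq p<q (Adj-sym t~σp)
  ... | tri≈ _ p≡q _ = contradiction (cong σ (toℕ-injective p≡q)) σp≢σq
  ... | tri> _ _ q<p = Adj-sym (t-nbr-sees-later-independent Kt ¬Kσp q<p (Adj-sym t~σq))

  mixed-nbrs-adjacent : ∀ {p q} → T (K t) → ¬ T (K (σ p)) → T (K (σ q)) →
    Adj G t (σ p) → Adj G t (σ q) → Adj G (σ p) (σ q)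
  mixed-nbrs-adjacent {p} {q} Kt ¬Kσp Kσq t~σp t~σq with <-cmp (toℕ p) (toℕ q)
  ... | tri< p<q _ _ = no-better-candidate (t-unnumbered q) numbered-nbrs-see-t p<q (Adj-sym t~σp)
    where
    numbered-nbrs-see-t : ∀ j → toℕ j < toℕ q → Adj G (σ j) (σ q) → Adj G (σ j) t
    numbered-nbrs-see-t j j<q σj~σq with T? (K (σ j)) | <-cmp (toℕ j) (toℕ p)
    ... | yes Kσj  | _            = clique (σ j) t Kσj Kt (t-unnumbered q j j<q)
    ... | no ¬Kσj  | tri< j<p _ _ = contradiction (independent-pick ¬Kσp Kσq (unnumbered-later (<⇒≤ p<q)) j<p σj~σq)
                                                  (independent (σ j) (σ p) ¬Kσj ¬Kσp)
    ... | no _     | tri≈ _ j≡p _ = subst (λ x → Adj G (σ x) t) (sym (toℕ-injective j≡p)) (Adj-sym t~σp)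
    ... | no ¬Kσj  | tri> _ _ p<j = contradiction (t-nbr-sees-later-independent Kt ¬Kσj p<j (Adj-sym t~σp))
                                                  (independent (σ p) (σ j) ¬Kσp ¬Kσj)
  ... | tri≈ _ p≡q _ = contradiction (subst (T ∘ K ∘ σ) (sym (toℕ-injective p≡q)) Kσq) ¬Kσp
  ... | tri> _ _ q<p = Adj-sym (t-nbr-sees-later-independent Kt ¬Kσp q<p (Adj-sym t~σq))

  last-simplicial : Simplicial G t
  last-simplicial u w t~u t~w u≢w with position u | position w
  ... | p , refl | q , refl with T? (K t) | T? (K (σ p)) | T? (K (σ q))
  ... | no ¬Kt | _       | _       = clique (σ p) (σ q) (nbr-of-independent ¬Kt t~u) (nbr-of-independent ¬Kt t~w) u≢w
  ... | yes _  | yes Kσp | yes Kσq = clique (σ p) (σ q) Kσp Kσq u≢w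
  ... | yes Kt | no ¬Kσp | yes Kσq = mixed-nbrs-adjacent Kt ¬Kσp Kσq t~u t~w
  ... | yes Kt | yes Kσp | no ¬Kσq = Adj-sym (mixed-nbrs-adjacent Kt ¬Kσq Kσp t~w t~u)
  ... | yes Kt | no ¬Kσp | no ¬Kσq = independent-nbrs-adjacent Kt ¬Kσp ¬Kσq t~u t~w u≢w

  module _ (¬Kt : ¬ T (K t)) where

    low⇒independent : ∀ {v} → deg G v < deg G t → ¬ T (K v)
    low⇒independent v<t Kv = <⇒≱ v<t (deg-independent≤deg-clique ¬Kt Kv)

    clique-numbered-before : ∀ {q j} → ¬ T (K (σ q)) → T (K (σ j)) → ¬ Adj G (σ q) (σ j) → toℕ j < toℕ q →
      ∀ k → T (K (σ k)) → toℕ k < toℕ q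
    clique-numbered-before {q} {j} ¬Kσq Kσj ¬σq~σj j<q k Kσk with toℕ k <? toℕ q
    ... | yes k<q = k<q
    ... | no  k≮q = contradiction (Adj-sym (independent-pick ¬Kσq Kσk σk-unn j<q σj~σk)) ¬σq~σj
      where
      σk-unn = unnumbered-later (≮⇒≥ k≮q)
      σj~σk = clique (σ j) (σ k) Kσj Kσk (σk-unn j j<q)

    -- Were z numbered before σ q, so would be the whole clique, and then the labels of t and
    -- σ q at step q would be their degrees.
    nbr-outside-unnumbered : ∀ {q z} → deg G (σ q) < deg G t → Adj G t z → ¬ Adj G (σ q) z → Unnumbered σ q z
    nbr-outside-unnumbered {q} q-low t~σj ¬σq~σj j j<q refl = contradiction (begin
      deg G t                  ≤⟨ deg≤numberedNbrs q t all-nbrs-numbered ⟩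
      numberedNbrs G σ q t     ≤⟨ proj₂ mcs q t (t-unnumbered q) ⟩
      numberedNbrs G σ q (σ q) ≤⟨ numberedNbrs≤deg q (σ q) ⟩
      deg G (σ q)              ∎) (<⇒≱ q-low)
      where
      open ≤-Reasoning
      all-nbrs-numbered : ∀ k → Adj G t (σ k) → toℕ k < toℕ q
      all-nbrs-numbered k t~σk = clique-numbered-before (low⇒independent q-low) (nbr-of-independent ¬Kt t~σj)
                                   ¬σq~σj j<q k (nbr-of-independent ¬Kt t~σk)

    earlier-⊆N-later : ∀ {p q} → ¬ T (K (σ p)) → deg G (σ q) < deg G t → toℕ p < toℕ q →
      _⊆N_ G (σ p) (σ q)
    earlier-⊆N-later {p} {q} ¬Kσp q-low p<q a σp~a = sees a (position a) (nbr-of-independent ¬Kσp σp~a) σp~a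
      where
      ¬Kσq = low⇒independent q-low
      outside = deg<⇒nbr-outside q-low
      z = proj₁ outside
      Kz = nbr-of-independent ¬Kt (proj₁ (proj₂ outside))
      z-unn = nbr-outside-unnumbered q-low (proj₁ (proj₂ outside)) (proj₂ (proj₂ outside))
      sees : ∀ x → ∃ (λ px → σ px ≡ x) → T (K x) → Adj G (σ p) x → Adj G (σ q) x
      sees _ (px , refl) Kσpx σp~σpx with <-cmp (toℕ px) (toℕ q)
      ... | tri< px<q _ _ = Adj-sym (independent-pick ¬Kσq Kz z-unn px<q (clique (σ px) z Kσpx Kz (z-unn px px<q)))
      ... | tri≈ _ px≡q _ = contradiction (subst (T ∘ K ∘ σ) (toℕ-injective px≡q) Kσpx) ¬Kσq
      ... | tri> _ _ q<px = contradiction (independent-pick ¬Kσq Kσpx (unnumbered-later (<⇒≤ q<px)) p<q σp~σpx)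
                                          (independent (σ p) (σ q) ¬Kσp ¬Kσq)

    last-lower-chain : LowerNbhdsChain G t
    last-lower-chain v w v-low w-low with position v | position w
    ... | p , refl | q , refl with <-cmp (toℕ p) (toℕ q)
    ... | tri< p<q _ _ = inj₁ (earlier-⊆N-later (low⇒independent v-low) w-low p<q)
    ... | tri≈ _ p≡q _ = inj₁ (subst (λ x → _⊆N_ G (σ p) (σ x)) (toℕ-injective p≡q) (λ _ a → a))
    ... | tri> _ _ q<p = inj₂ (earlier-⊆N-later (low⇒independent w-low) v-low q<p)

module GreedyMCS {m : ℕ} (G : Graph (suc m)) (t : Fin (suc m))
                 (Inv : (Fin (suc m) → Bool) → Set) (Inv-∅ : Inv (λ _ → false)) where
  open Graph G using (adj)
  open GraphProperties G

  private
    Vertex = Fin (suc m)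
    VSet   = Vertex → Bool

  record Extension (S : VSet) (u : Vertex) : Set where
    field
      fresh     : ¬ T (S u)
      not-last  : u ≢ t
      preserves : Inv (insert S u)
      maximal   : ∀ y → ¬ T (S y) → label S y ≤ label S u

  Exhausted : VSet → Set
  Exhausted S = ∀ u → ¬ T (S u) → u ≡ t

  exhausted⇒m≤count : ∀ S → ¬ T (S t) → Exhausted S → m ≤ count S
  exhausted⇒m≤count S t∉S exhausted = ≤-pred (begin
    suc m                      ≡⟨ count-all ⟨
    count {suc m} (λ _ → true) ≤⟨ count-mono {q = insert S t} all⊆ ⟩
    count (insert S t)         ≡⟨ count-insert S t t∉S ⟩
    suc (count S)              ∎)
    where
    open ≤-Reasoning
    all⊆ : (λ _ → true) ⊆ᵇ insert S t
    all⊆ z _ with T? (S z)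
    ... | yes Sz = ∈-insert⁺ S t Sz
    ... | no ¬Sz = subst (T ∘ insert S t) (sym (exhausted z ¬Sz)) (∈-insert-self S t)

  fresh⇒count<m : ∀ S {u} → ¬ T (S t) → ¬ T (S u) → u ≢ t → count S < m
  fresh⇒count<m S {u} t∉S u∉S u≢t = ≤-pred (begin
    suc (suc (count S))           ≡⟨ cong suc (count-insert S u u∉S) ⟨
    suc (count (insert S u))      ≡⟨ count-insert (insert S u) t (∉-insert S t∉S (u≢t ∘ sym)) ⟨
    count (insert (insert S u) t) ≤⟨ count-mono {p = insert (insert S u) t} {q = λ _ → true} (λ _ _ → _) ⟩
    count {suc m} (λ _ → true)    ≡⟨ count-all ⟩
    suc m                         ∎)
    where open ≤-Reasoning

  module Construction
    (extend : ∀ S → Inv S → ¬ T (S t) → ∃ (λ u → ¬ T (S u) × u ≢ t) → Σ Vertex (Extension S)) where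

    record State : Set where
      constructor state
      field
        numbered  : VSet
        invariant : Inv numbered
        t-fresh   : ¬ T (numbered t)
    open State

    Choice : State → Set
    Choice st = Σ Vertex (Extension (numbered st)) ⊎ Exhausted (numbered st)

    choose : (st : State) → Choice st
    choose (state S inv t∉S) with any? (λ u → ¬? (T? (S u)) ×-dec ¬? (u ≟ t))
    ... | yes other = inj₁ (extend S inv t∉S other)
    ... | no ¬other = inj₂ λ u u∉S → decidable-stable (u ≟ t) (λ u≢t → ¬other (u , u∉S , u≢t))

    pick : ∀ st → Choice st → Vertex
    pick _ (inj₁ (u , _)) = u
    pick _ (inj₂ _)       = t

    advance : (st : State) → Choice st → State
    advance (state S _ t∉S) (inj₁ (u , ext)) =
      state (insert S u) (Extension.preserves ext) (∉-insert S t∉S (Extension.not-last ext ∘ sym))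
    advance st (inj₂ _) = st

    extends : ∀ st (c : Choice st) → count (numbered st) < m →
      Extension (numbered st) (pick st c) × numbered (advance st c) ≡ insert (numbered st) (pick st c)
    extends _ (inj₁ (u , ext)) _ = ext , refl
    extends st (inj₂ exhausted) c<m = contradiction (exhausted⇒m≤count (numbered st) (t-fresh st) exhausted) (<⇒≱ c<m)

    picks-last : ∀ st (c : Choice st) → count (numbered st) ≡ m → pick st c ≡ t
    picks-last st (inj₁ (u , ext)) c≡m =
      contradiction c≡m (<⇒≢ (fresh⇒count<m (numbered st) (t-fresh st) (Extension.fresh ext) (Extension.not-last ext)))
    picks-last _ (inj₂ _) _ = refl

    full⇒exhausted : ∀ st → count (numbered st) ≡ m → Exhausted (numbered st)
    full⇒exhausted st c≡m u u∉S =
      decidable-stable (u ≟ t) (λ u≢t → <⇒≢ (fresh⇒count<m (numbered st) (t-fresh st) u∉S u≢t) c≡m)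

    stage : ℕ → State
    stage zero    = state (λ _ → false) Inv-∅ (λ ())
    stage (suc k) = advance (stage k) (choose (stage k))

    numberedAt : ℕ → VSet
    numberedAt k = numbered (stage k)

    order : ℕ → Vertex
    order k = pick (stage k) (choose (stage k))

    count-stage : ∀ k → k ≤ m → count (numberedAt k) ≡ k
    stage-extends : ∀ k → k < m →
      Extension (numberedAt k) (order k) × numberedAt (suc k) ≡ insert (numberedAt k) (order k)

    count-stage zero    _   = count-none {p = numberedAt 0} (λ _ ())
    count-stage (suc k) k<m = begin
      count (numberedAt (suc k))              ≡⟨ cong count (proj₂ (stage-extends k k<m)) ⟩
      count (insert (numberedAt k) (order k)) ≡⟨ count-insert (numberedAt k) (order k) fresh ⟩
      suc (count (numberedAt k))              ≡⟨ cong suc (count-stage k (<⇒≤ k<m)) ⟩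
      suc k                                   ∎
      where
      open ≡-Reasoning
      fresh = Extension.fresh (proj₁ (stage-extends k k<m))

    stage-extends k k<m = extends (stage k) (choose (stage k)) (subst (_< m) (sym (count-stage k (<⇒≤ k<m))) k<m)

    order-last : order m ≡ t
    order-last = picks-last (stage m) (choose (stage m)) (count-stage m ≤-refl)

    order-fresh : ∀ k → k ≤ m → ¬ T (numberedAt k (order k))
    order-fresh k k≤m with m≤n⇒m<n∨m≡n k≤m
    ... | inj₁ k<m  = Extension.fresh (proj₁ (stage-extends k k<m))
    ... | inj₂ refl = subst (¬_ ∘ T ∘ numberedAt k) (sym order-last) (t-fresh (stage k))

    numbered⇒ordered-before : ∀ k → k ≤ m → ∀ z → T (numberedAt k z) → ∃ λ j → j < k × order j ≡ z
    numbered⇒ordered-before (suc k) k<m z z∈S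
      with ∈-insert⁻ (numberedAt k) (order k) (subst (λ S → T (S z)) (proj₂ (stage-extends k k<m)) z∈S)
    ... | inj₁ refl = k , ≤-refl , refl
    ... | inj₂ z∈S′ with j , j<k , order-j≡z ← numbered⇒ordered-before k (<⇒≤ k<m) z z∈S′ =
      j , m≤n⇒m≤1+n j<k , order-j≡z

    ordered-before⇒numbered : ∀ k → k ≤ m → ∀ j → j < k → T (numberedAt k (order j))
    ordered-before⇒numbered (suc k) k<m j j<1+k =
      subst (λ S → T (S (order j))) (sym (proj₂ (stage-extends k k<m))) (in-extension (m≤n⇒m<n∨m≡n (≤-pred j<1+k)))
      where
      in-extension : j < k ⊎ j ≡ k → T (insert (numberedAt k) (order k) (order j))
      in-extension (inj₁ j<k)  = ∈-insert⁺ (numberedAt k) (order k) (ordered-before⇒numbered k (<⇒≤ k<m) j j<k)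
      in-extension (inj₂ refl) = ∈-insert-self (numberedAt k) (order k)

    order-injective : ∀ {j k} → j ≤ m → k ≤ m → order j ≡ order k → j ≡ k
    order-injective {j} {k} j≤m k≤m order-j≡order-k with <-cmp j k
    ... | tri< j<k _ _ = contradiction (subst (T ∘ numberedAt k) order-j≡order-k (ordered-before⇒numbered k k≤m j j<k))
                                       (order-fresh k k≤m)
    ... | tri≈ _ j≡k _ = j≡k
    ... | tri> _ _ k<j = contradiction (subst (T ∘ numberedAt j) (sym order-j≡order-k) (ordered-before⇒numbered j j≤m k k<j))
                                       (order-fresh j j≤m)

    σ : Vertex → Vertex
    σ i = order (toℕ i)

    toℕ≤m : (i : Vertex) → toℕ i ≤ m
    toℕ≤m i = ≤-pred (toℕ<n i)

    σ-injective : Injective _≡_ _≡_ σ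
    σ-injective {i} {j} σi≡σj = toℕ-injective (order-injective (toℕ≤m i) (toℕ≤m j) σi≡σj)

    numbered⇒before : ∀ i j → T (numberedAt (toℕ i) (σ j)) → toℕ j < toℕ i
    numbered⇒before i j σj∈S with j′ , j′<i , order-j′≡σj ← numbered⇒ordered-before (toℕ i) (toℕ≤m i) (σ j) σj∈S =
      subst (_< toℕ i) (order-injective (≤-trans (<⇒≤ j′<i) (toℕ≤m i)) (toℕ≤m j) order-j′≡σj) j′<i

    numberedNbrs≡label : ∀ i v → numberedNbrs G σ i v ≡ label (numberedAt (toℕ i)) v
    numberedNbrs≡label i v = begin
      numberedNbrs G σ i v                                        ≡⟨ numberedNbrs≡count σ i v ⟩
      count (numberedNbrPositions σ i v)                          ≡⟨ count-cong positions⊆numbered numbered⊆positions ⟩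
      count (λ j → numberedAt (toℕ i) (σ j) ∧ adj (σ j) v)        ≡⟨ count-reindex σ-injective (λ z → numberedAt (toℕ i) z ∧ adj z v) ⟩
      label (numberedAt (toℕ i)) v                                ∎
      where
      open ≡-Reasoning
      positions⊆numbered : numberedNbrPositions σ i v ⊆ᵇ (λ j → numberedAt (toℕ i) (σ j) ∧ adj (σ j) v)
      positions⊆numbered j h with j<i , σj~v ← ∧-elim h =
        ∧-intro (ordered-before⇒numbered (toℕ i) (toℕ≤m i) (toℕ j) (<?-sound j<i)) σj~v
      numbered⊆positions : (λ j → numberedAt (toℕ i) (σ j) ∧ adj (σ j) v) ⊆ᵇ numberedNbrPositions σ i v
      numbered⊆positions j h with σj∈S , σj~v ← ∧-elim h = ∧-intro (<?-complete (numbered⇒before i j σj∈S)) σj~v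

    σ-maximal : ∀ i u → Unnumbered σ i u → numberedNbrs G σ i u ≤ numberedNbrs G σ i (σ i)
    σ-maximal i u u-unn = subst₂ _≤_ (sym (numberedNbrs≡label i u)) (sym (numberedNbrs≡label i (σ i)))
                                    (by-stage (m≤n⇒m<n∨m≡n (toℕ≤m i)))
      where
      S = numberedAt (toℕ i)
      u∉S : ¬ T (S u)
      u∉S u∈S with j , j<i , order-j≡u ← numbered⇒ordered-before (toℕ i) (toℕ≤m i) u u∈S =
        u-unn (fromℕ< j<n) (subst (_< toℕ i) (sym (toℕ-fromℕ< j<n)) j<i)
              (trans (cong order (toℕ-fromℕ< j<n)) order-j≡u)
        where j<n = <-trans j<i (toℕ<n i)
      by-stage : toℕ i < m ⊎ toℕ i ≡ m → label S u ≤ label S (σ i)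
      by-stage (inj₁ i<m) = Extension.maximal (proj₁ (stage-extends (toℕ i) i<m)) u u∉S
      by-stage (inj₂ i≡m) = ≤-reflexive (cong (label S) (trans u≡t (sym (trans (cong order i≡m) order-last))))
        where
        u≡t = full⇒exhausted (stage (toℕ i)) (trans (count-stage (toℕ i) (toℕ≤m i)) i≡m) u u∉S

    last-of-some-mcs : LastOfSomeMCS G t
    last-of-some-mcs = σ , (σ-injective , σ-maximal) , fromℕ m ,
                       trans (cong order (toℕ-fromℕ m)) order-last , cong suc (toℕ-fromℕ m)

module GreedySplitMCS {m : ℕ} {G : Graph (suc m)} {K : Fin (suc m) → Bool} (split : SplitPartition G K)
                      {t : Fin (suc m)} (¬Kt : ¬ T (K t)) (chain : LowerNbhdsChain G t) where
  open Graph G using (adj)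
  open GraphProperties G
  open SplitPartition split
  open SplitPartitionProperties split

  private
    Vertex = Fin (suc m)
    VSet   = Vertex → Bool

  Low : Vertex → Set
  Low l = ¬ T (K l) × deg G l < deg G t

  low? : Decidable Low
  low? l = ¬? (T? (K l)) ×-dec (deg G l <? deg G t)

  Invariant : VSet → Set
  Invariant S = ∀ l → Low l → ¬ T (S l) →
    (∀ k → T (K k) → T (S k) → Adj G l k) × (∀ x → ¬ T (K x) → T (S x) → _⊆N_ G x l)

  invariant-∅ : Invariant (λ _ → false)
  invariant-∅ _ _ _ = (λ _ _ ()) , (λ _ _ ())

  open GreedyMCS G t Invariant invariant-∅ using (Extension; module Construction)

  Exposed : VSet → Vertex → Set
  Exposed S k = T (K k) × ¬ T (S k) × ∃ λ x → ¬ T (K x) × T (S x) × Adj G k x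

  exposed? : ∀ S → Decidable (Exposed S)
  exposed? S k = T? (K k) ×-dec ¬? (T? (S k)) ×-dec any? (λ x → ¬? (T? (K x)) ×-dec T? (S x) ×-dec T? (adj k x))

  module _ (S : VSet) (inv : Invariant S) where

    extend-clique-numbered : (∀ k → T (K k) → T (S k)) → ∃ (λ u → ¬ T (S u) × u ≢ t) → Σ Vertex (Extension S)
    extend-clique-numbered K⊆S (u₀ , u₀-ok) = u , record
      { fresh     = u∉S
      ; not-last  = proj₂ (proj₁ (proj₂ best))
      ; preserves = λ l l-low l∉S+u → contradiction (l∉S+u ∘ ∈-insert⁺ S u) (low-numbered l l-low)
      ; maximal   = maximal
      }
      where
      low-numbered : ∀ l → Low l → ¬ ¬ T (S l)
      low-numbered l l-low@(_ , l<t) l∉S = <⇒≱ l<t (deg-mono λ z t~z →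
        let Kz = nbr-of-independent ¬Kt t~z in proj₁ (inv l l-low l∉S) z Kz (K⊆S z Kz))

      label≡deg : ∀ x → ¬ T (K x) → label S x ≡ deg G x
      label≡deg x ¬Kx = trans (count-cong {p = λ z → S z ∧ adj z x} {q = adj x}
        (λ z h → Adj-sym (proj₂ (∧-elim h)))
        (λ z x~z → ∧-intro (K⊆S z (nbr-of-independent ¬Kx x~z)) (Adj-sym x~z))) (sym (deg≡count x))

      best = maximiser (λ y → ¬? (T? (S y)) ×-dec ¬? (y ≟ t)) (label S) u₀-ok
      u = proj₁ best
      u∉S = proj₁ (proj₁ (proj₂ best))
      ¬Ku : ¬ T (K u)
      ¬Ku = u∉S ∘ K⊆S u

      maximal : ∀ y → ¬ T (S y) → label S y ≤ label S u
      maximal y y∉S with y ≟ t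
      ... | no  y≢t  = proj₂ (proj₂ best) y (y∉S , y≢t)
      ... | yes refl = begin
        label S t ≡⟨ label≡deg t ¬Kt ⟩
        deg G t   ≤⟨ ≮⇒≥ (λ u<t → low-numbered u (¬Ku , u<t) u∉S) ⟩
        deg G u   ≡⟨ label≡deg u ¬Ku ⟨
        label S u ∎
        where open ≤-Reasoning

    extend-at-clique : ∃ (λ k → T (K k) × ¬ T (S k)) → ∃ (Exposed S) ⊎ ¬ ∃ (λ l → Low l × ¬ T (S l)) →
      Σ Vertex (Extension S)
    extend-at-clique (k₀ , k₀-ok) exposed-or-no-low = k , record
      { fresh     = k∉S
      ; not-last  = λ k≡t → ¬Kt (subst (T ∘ K) k≡t Kk)
      ; preserves = preserves
      ; maximal   = maximal
      }
      where
      best = maximiser (λ y → T? (K y) ×-dec ¬? (T? (S y))) (label S) k₀-ok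
      k = proj₁ best
      Kk = proj₁ (proj₁ (proj₂ best))
      k∉S = proj₂ (proj₁ (proj₂ best))
      k-max = proj₂ (proj₂ best)

      numbered-clique-nbrs-see : ∀ {y k′} → T (K k′) → ¬ T (S k′) → (∀ z → T (S z) → Adj G z y → T (K z)) →
        ∀ z → T (S z) → Adj G z y → Adj G z k′
      numbered-clique-nbrs-see Kk′ k′∉S in-clique z z∈S z~y =
        clique z _ (in-clique z z∈S z~y) Kk′ (λ z≡k′ → k′∉S (subst (T ∘ S) z≡k′ z∈S))

      maximal : ∀ y → ¬ T (S y) → label S y ≤ label S k
      maximal y y∉S with T? (K y)
      ... | yes Ky  = k-max y (Ky , y∉S)
      ... | no  ¬Ky = label-mono S (numbered-clique-nbrs-see Kk k∉S λ z _ z~y → nbr-of-independent ¬Ky (Adj-sym z~y))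

      -- Otherwise all numbered neighbours of k lie in the clique, and the exposed k₁ has a larger label.
      low-sees-k : ∃ (Exposed S) ⊎ ¬ ∃ (λ l → Low l × ¬ T (S l)) → ∀ l → Low l → ¬ T (S l) → Adj G l k
      low-sees-k (inj₂ no-low) l l-low l∉S = contradiction (l , l-low , l∉S) no-low
      low-sees-k (inj₁ (k₁ , Kk₁ , k₁∉S , x₀ , ¬Kx₀ , x₀∈S , k₁~x₀)) l l-low l∉S
          with any? (λ x → ¬? (T? (K x)) ×-dec T? (S x) ×-dec T? (adj k x))
      ...   | yes (x , ¬Kx , x∈S , k~x) = proj₂ (inv l l-low l∉S) x ¬Kx x∈S k (Adj-sym k~x)
      ...   | no ¬exposed = contradiction (k-max k₁ (Kk₁ , k₁∉S)) (<⇒≱ (label-mono-< S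
              (numbered-clique-nbrs-see Kk₁ k₁∉S in-clique) x₀ x₀∈S (Adj-sym k₁~x₀)
              (λ x₀~k → ¬exposed (x₀ , ¬Kx₀ , x₀∈S , Adj-sym x₀~k))))
        where
        in-clique : ∀ z → T (S z) → Adj G z k → T (K z)
        in-clique z z∈S z~k = decidable-stable (T? (K z)) (λ ¬Kz → ¬exposed (z , ¬Kz , z∈S , Adj-sym z~k))

      preserves : Invariant (insert S k)
      preserves l l-low l∉S+k = clique-part , independent-part
        where
        l∉S = l∉S+k ∘ ∈-insert⁺ S k
        clique-part : ∀ k′ → T (K k′) → T (insert S k k′) → Adj G l k′
        clique-part k′ Kk′ k′∈S+k with ∈-insert⁻ S k k′∈S+k
        ... | inj₁ refl  = low-sees-k exposed-or-no-low l l-low l∉S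
        ... | inj₂ k′∈S = proj₁ (inv l l-low l∉S) k′ Kk′ k′∈S
        independent-part : ∀ x → ¬ T (K x) → T (insert S k x) → _⊆N_ G x l
        independent-part x ¬Kx x∈S+k with ∈-insert⁻ S k x∈S+k
        ... | inj₁ refl = contradiction Kk ¬Kx
        ... | inj₂ x∈S  = proj₂ (inv l l-low l∉S) x ¬Kx x∈S

    extend-at-low : (∀ k → ¬ Exposed S k) → ∃ (λ l → Low l × ¬ T (S l)) → Σ Vertex (Extension S)
    extend-at-low unexposed (l₀ , l₀-ok) = l* , record
      { fresh     = l*∉S
      ; not-last  = λ l*≡t → <-irrefl (cong (deg G) l*≡t) (proj₂ l*-low)
      ; preserves = preserves
      ; maximal   = λ y y∉S → label-mono S λ z z∈S z~y → Adj-sym (sees-numbered-nbr y∉S z∈S z~y)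
      }
      where
      best = minimiser (λ l → low? l ×-dec ¬? (T? (S l))) (deg G) l₀-ok
      l* = proj₁ best
      l*-low = proj₁ (proj₁ (proj₂ best))
      l*∉S = proj₂ (proj₁ (proj₂ best))

      sees-numbered-nbr : ∀ {y z} → ¬ T (S y) → T (S z) → Adj G z y → Adj G l* z
      sees-numbered-nbr {y} {z} y∉S z∈S z~y with T? (K z)
      ... | yes Kz  = proj₁ (inv l* l*-low l*∉S) z Kz z∈S
      ... | no  ¬Kz = contradiction (nbr-of-independent ¬Kz z~y , y∉S , z , ¬Kz , z∈S , Adj-sym z~y) (unexposed y)

      l*⊆N-low : ∀ l → Low l → ¬ T (S l) → _⊆N_ G l* l
      l*⊆N-low l l-low l∉S with chain l* l (proj₂ l*-low) (proj₂ l-low)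
      ... | inj₁ l*⊆l = l*⊆l
      ... | inj₂ l⊆l* = ⊆N∧deg≤⇒⊇N l⊆l* (proj₂ (proj₂ best) l (l-low , l∉S))

      preserves : Invariant (insert S l*)
      preserves l l-low l∉S+l* = clique-part , independent-part
        where
        l∉S = l∉S+l* ∘ ∈-insert⁺ S l*
        clique-part : ∀ k → T (K k) → T (insert S l* k) → Adj G l k
        clique-part k Kk k∈S+l* with ∈-insert⁻ S l* k∈S+l*
        ... | inj₁ refl = contradiction Kk (proj₁ l*-low)
        ... | inj₂ k∈S  = proj₁ (inv l l-low l∉S) k Kk k∈S
        independent-part : ∀ x → ¬ T (K x) → T (insert S l* x) → _⊆N_ G x l
        independent-part x ¬Kx x∈S+l* with ∈-insert⁻ S l* x∈S+l*
        ... | inj₁ refl = l*⊆N-low l l-low l∉S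
        ... | inj₂ x∈S  = proj₂ (inv l l-low l∉S) x ¬Kx x∈S

  extend : ∀ S → Invariant S → ¬ T (S t) → ∃ (λ u → ¬ T (S u) × u ≢ t) → Σ Vertex (Extension S)
  extend S inv _ other with any? (λ k → T? (K k) ×-dec ¬? (T? (S k)))
  ... | no ¬clique-left = extend-clique-numbered S inv K⊆S other
    where
    K⊆S : ∀ k → T (K k) → T (S k)
    K⊆S k Kk = decidable-stable (T? (S k)) (λ k∉S → ¬clique-left (k , Kk , k∉S))
  ... | yes clique-left with any? (exposed? S) | any? (λ l → low? l ×-dec ¬? (T? (S l)))
  ...   | yes exposed | _       = extend-at-clique S inv clique-left (inj₁ exposed)
  ...   | no _        | no ¬low = extend-at-clique S inv clique-left (inj₂ ¬low)
  ...   | no ¬exposed | yes low = extend-at-low S inv (λ k e → ¬exposed (k , e)) low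

  last-of-some-mcs : LastOfSomeMCS G t
  last-of-some-mcs = Construction.last-of-some-mcs extend

theorem13 : ∀ {n} (G : Graph n) → Connected G → IsSplit G → (t : Fin n) →
    (LastOfSomeMCS G t ⇔ (Simplicial G t × LowerNbhdsChain G t))
theorem13 {zero}  _ _ _ ()
theorem13 {suc m} G _ (K , clique , independent) t = mk⇔ necessary sufficient
  where
  split : SplitPartition G K
  split = record { clique = clique ; independent = independent }

  necessary : LastOfSomeMCS G t → Simplicial G t × LowerNbhdsChain G t
  necessary (σ , mcs , l , refl , l-last) = simplicial , chain
    where
    simplicial : Simplicial G (σ l)
    simplicial = LastVertexOfMCS.last-simplicial split mcs l-last
    chain : LowerNbhdsChain G (σ l)
    chain with K′ , split′ , ¬K′t ← simplicial⇒independent-side split simplicial =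
      LastVertexOfMCS.last-lower-chain split′ mcs l-last ¬K′t

  sufficient : Simplicial G t × LowerNbhdsChain G t → LastOfSomeMCS G t
  sufficient (simplicial , chain) with K′ , split′ , ¬K′t ← simplicial⇒independent-side split simplicial =
    GreedySplitMCS.last-of-some-mcs split′ ¬K′t chain
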